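{- Let $I$ be a finite simple graph and let $a,b$ be two distinct vertices of $I$. Then \[ {}^\partial\varepsilon_{I}(z)-{}^\partial\varepsilon_{I_{ab}'}(z)-{}^\partial\varepsilon_{\tilde{I}_{ab}}(z)+{}^\partial\varepsilon_{\tilde{I}_{ab}'}(z)=0 . \]
   Context: For a finite simple graph $I$ with adjacency matrix $M_I$ over $\mathbb{Z}_2$ (entry $1$ iff the two vertices are adjacent, zero diagonal), and $A\subseteq V(I)$, let $M_A$ be the principal submatrix of $M_I$ indexed by $A$ (the adjacency matrix of the induced subgraph on $A$), and $A^c=V(I)\setminus A$. The partial-dual genus polynomial of $I$ is ${}^\partial\varepsilon_I(z)=\sum_{A\subseteq V(I)} z^{\operatorname{rank}(M_A)+\operatorname{rank}(M_{A^c})}$, where rank is over $\mathbb{Z}_2$ and the empty matrix has rank $0$. For vertices $a,b$: $I_{ab}'$ is the graph obtained from $I$ by toggling the adjacency between $a$ and $b$ (removing the edge $ab$ if present, adding it otherwise). $\tilde{I}_{ab}$ is obtained from $I$ as follows: let $c_1,\dots,c_k$ be the neighbours of $b$ other than $a$; toggle the adjacency between $a$ and each $c_i$, $1\le i\le k$. Finally $\tilde{I}_{ab}'$ denotes the graph obtained by applying both operations, i.e. $(\tilde{I}_{ab})'_{ab}=\widetilde{(I_{ab}')}_{ab}$. -}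

module Defs where

open import Data.Bool using (Bool; true; false; not; _∧_; _∨_; _xor_; if_then_else_; T)
open import Data.Nat using (ℕ; zero; suc; _+_; _⊔_)
open import Data.Fin using (Fin; _≟_)
open import Data.List using (List; []; _∷_; map; length; foldr; filter; _++_; allFin)
import Data.List as L
open import Data.Vec using (Vec; lookup)
import Data.Vec as V
open import Relation.Nullary.Decidable using (⌊_⌋)
import Relation.Nullary.Decidable as Dec
open import Relation.Binary.PropositionalEquality using (_≡_)
open import Data.Integer using (ℤ)
import Data.Integer as ℤ

-- Graphs on vertex set Fin n, given by their adjacency matrix over Z_2
-- (true = 1 = adjacent).  A finite simple graph is one whose adjacency
-- matrix is symmetric with zero diagonal.

Adj : ℕ → Set
Adj n = Fin n → Fin n → Bool

IsSimpleGraph : ∀ {n} → Adj n → Set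
IsSimpleGraph {n} M = (∀ i j → M i j ≡ M j i) × (∀ i → M i i ≡ false)
  where open import Data.Product using (_×_)

addV : List Bool → List Bool → List Bool
addV [] ys = ys
addV xs [] = xs
addV (x ∷ xs) (y ∷ ys) = (x xor y) ∷ addV xs ys

sumV : List (List Bool) → List Bool
sumV = foldr addV []

allB : ∀ {A : Set} → (A → Bool) → List A → Bool
allB p = foldr (λ x r → p x ∧ r) true

isZeroV : List Bool → Bool
isZeroV = allB not

sublists : ∀ {A : Set} → List A → List (List A)
sublists [] = [] ∷ []
sublists (x ∷ xs) = let r = sublists xs in r ++ map (x ∷_) r

nonEmpty : ∀ {A : Set} → List A → Bool
nonEmpty [] = false
nonEmpty (_ ∷ _) = true

independent : List (List Bool) → Bool
independent rs = allB (λ s → not (nonEmpty s ∧ isZeroV (sumV s))) (sublists rs)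

maxList : List ℕ → ℕ
maxList = foldr _⊔_ 0

rank : List (List Bool) → ℕ
rank rs = maxList (map length (filter (λ s → Dec.T? (independent s)) (sublists rs)))

allSubsets : (n : ℕ) → List (Vec Bool n)
allSubsets zero = V.[] ∷ []
allSubsets (suc n) = map (false V.∷_) (allSubsets n) ++ map (true V.∷_) (allSubsets n)

elems : ∀ {n} → Vec Bool n → List (Fin n)
elems {n} A = filter (λ i → Dec.T? (lookup A i)) (allFin n)

complement : ∀ {n} → Vec Bool n → Vec Bool n
complement = V.map not

principal : ∀ {n} → Adj n → Vec Bool n → List (List Bool)
principal M A = map (λ i → map (λ j → M i j) (elems A)) (elems A)

-- coefficient of z^k in the partial-dual genus polynomial:
-- the number of A ⊆ V(I) with rank(M_A) + rank(M_{A^c}) = k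
pdgCoeff : ∀ {n} → Adj n → ℕ → ℕ
pdgCoeff {n} M k =
  length (filter (λ A → k Data.Nat.≟ (rank (principal M A) + rank (principal M (complement A))))
                 (allSubsets n))

eqB : ∀ {n} → Fin n → Fin n → Bool
eqB i j = ⌊ i ≟ j ⌋

toggleAB : ∀ {n} → Fin n → Fin n → Adj n → Adj n
toggleAB a b M i j =
  if (eqB i a ∧ eqB j b) ∨ (eqB i b ∧ eqB j a) then not (M i j) else M i j

-- Ĩ_{ab}: for every neighbour c of b with c ≠ a, toggle the adjacency
-- between a and c
tildeAB : ∀ {n} → Fin n → Fin n → Adj n → Adj n
tildeAB a b M i j =
  if (eqB i a ∧ not (eqB j a) ∧ M b j) ∨ (eqB j a ∧ not (eqB i a) ∧ M b i)
  then not (M i j) else M i j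

tildeAB' : ∀ {n} → Fin n → Fin n → Adj n → Adj n
tildeAB' a b M = toggleAB a b (tildeAB a b M)

-- coefficient of z^k in  ∂ε_I - ∂ε_{I'_{ab}} - ∂ε_{Ĩ_{ab}} + ∂ε_{Ĩ'_{ab}}
combCoeff : ∀ {n} → Fin n → Fin n → Adj n → ℕ → ℤ
combCoeff a b M k =
  ((ℤ.+ pdgCoeff M k ℤ.- ℤ.+ pdgCoeff (toggleAB a b M) k)
     ℤ.- ℤ.+ pdgCoeff (tildeAB a b M) k)
     ℤ.+ ℤ.+ pdgCoeff (tildeAB' a b M) k

-- For A ⊆ V(I) let e_X(A) = rank X_A + rank X_{A^c}, the exponent that A contributes.
-- If A separates a and b, toggling ab changes neither X_A nor X_{A^c}, so e_I(A) = e_{I'}(A)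
-- and e_Ĩ(A) = e_{Ĩ'}(A). Otherwise the side of A without a is untouched by I ↦ Ĩ, while on
-- the side containing a and b, Ĩ arises from I by adding column b to column a and then row b
-- to row a, which keeps the rank; since I ↦ Ĩ commutes with toggling ab, e_I(A) = e_Ĩ(A) and
-- e_{I'}(A) = e_{Ĩ'}(A). Either way the four terms for A cancel in pairs.
-- The rank is the largest size of a linearly independent family of rows: the column operation
-- keeps every linear relation among the rows, the row operation needs an exchange argument.

module Submission where

open import Defs
open import Data.Bool using (Bool; true; false; not; _∧_; _∨_; _xor_; if_then_else_)
open import Data.Bool.Properties
  using (∧-comm; ∨-comm; ∧-zeroʳ; ∧-identityʳ; xor-assoc; xor-identityʳ; ∧-distribˡ-xor;
         ∧-distribʳ-xor; not-injective; T-≡; xor-∧-commutativeRing; ∧-conicalˡ; ∧-conicalʳ; ∧-assoc;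
         xor-same)
  renaming (_≟_ to _≟ᵇ_)
open import Data.Empty using (⊥; ⊥-elim)
open import Data.Fin using (Fin; _≟_)
open import Data.Integer using (0ℤ)
import Data.Integer as ℤ
import Data.Integer.Properties as ℤ
open import Data.Integer.Solver using (module +-*-Solver)
open import Data.List using (List; []; _∷_; map; length; filter; filterᵇ; _++_; allFin)
open import Data.List.Properties using (map-++; map-∘; map-cong; map-cong-local; length-map)
open import Data.List.Membership.Propositional using (_∈_)
open import Data.List.Membership.Propositional.Properties
  using (∈-++⁺ˡ; ∈-++⁺ʳ; ∈-++⁻; ∈-map⁺; ∈-map⁻; ∈-filter⁺; ∈-filter⁻; ∈-allFin)
open import Data.List.Relation.Unary.All using (All)
import Data.List.Relation.Unary.All as All
open import Data.List.Relation.Unary.AllPairs using ([]; _∷_)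
open import Data.List.Relation.Unary.Any using (here; there)
open import Data.List.Relation.Unary.Unique.Propositional using (Unique)
import Data.List.Relation.Unary.Unique.Propositional.Properties as Unique
open import Data.Nat using (ℕ; suc; _+_; _≤_)
import Data.Nat as ℕ
open import Data.Nat.Properties
  using (≤-refl; ≤-reflexive; ≤-trans; ≤-antisym; m≤m⊔n; m≤n⇒m≤o⊔n; ⊔-sel; +-comm;
         +-commutativeSemigroup)
open import Algebra.Properties.CommutativeSemigroup +-commutativeSemigroup using (interchange)
open import Algebra.Bundles using (CommutativeRing)
open import Algebra.Properties.CommutativeSemigroup
  (CommutativeRing.+-commutativeSemigroup xor-∧-commutativeRing)
  using () renaming (interchange to xor-interchange; x∙yz≈y∙xz to xor-left-comm)
open import Data.Product using (∃-syntax; _×_; _,_; proj₂)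
open import Data.Sum using (_⊎_; inj₁; inj₂)
open import Data.Vec using (Vec; lookup)
open import Data.Vec.Properties using (lookup-map)
open import Data.Vec.Functional using (Vector; updateAt)
open import Data.Vec.Functional.Properties using (updateAt-updates; updateAt-minimal)
open import Function using (_∘_; const)
open import Function.Bundles using (Equivalence)
open import Relation.Nullary using (¬_; Dec; yes; no; does)
open import Relation.Nullary.Decidable using (T?)
open import Relation.Binary.PropositionalEquality
  using (_≡_; _≢_; refl; sym; trans; cong; cong₂; subst; subst₂; module ≡-Reasoning)

true≢false : true ≢ false
true≢false ()

xor-cancelʳ : ∀ x y → (x xor y) xor y ≡ x
xor-cancelʳ x y = trans (xor-assoc x y y) (trans (cong (x xor_) (xor-same y)) (xor-identityʳ x))

xor-true : ∀ {x y} → x xor y ≡ true → x ≡ true ⊎ y ≡ true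
xor-true {true}          _ = inj₁ refl
xor-true {false} {true}  _ = inj₂ refl

∧-distribˡ-xor-∧ : ∀ r x e y → r ∧ (x xor (e ∧ y)) ≡ (r ∧ x) xor (e ∧ (r ∧ y))
∧-distribˡ-xor-∧ true  x e y = refl
∧-distribˡ-xor-∧ false x e y = sym (∧-zeroʳ e)

eqB-refl : ∀ {n} (x : Fin n) → eqB x x ≡ true
eqB-refl x with x ≟ x
... | yes _   = refl
... | no x≢x = ⊥-elim (x≢x refl)

eqB-≢ : ∀ {n} {x y : Fin n} → x ≢ y → eqB x y ≡ false
eqB-≢ {x = x} {y} x≢y with x ≟ y
... | yes x≡y = ⊥-elim (x≢y x≡y)
... | no _    = refl

module _ {X : Set} where

  ∈-nonEmpty : ∀ {x : X} {xs} → x ∈ xs → nonEmpty xs ≡ true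
  ∈-nonEmpty (here _)  = refl
  ∈-nonEmpty (there _) = refl

  nonEmpty-∈ : ∀ (xs : List X) → nonEmpty xs ≡ true → ∃[ x ] x ∈ xs
  nonEmpty-∈ (x ∷ _) _ = x , here refl

  allB⁺ : ∀ {p : X → Bool} xs → (∀ x → x ∈ xs → p x ≡ true) → allB p xs ≡ true
  allB⁺ []       h = refl
  allB⁺ (x ∷ xs) h rewrite h x (here refl) = allB⁺ xs (λ y y∈ → h y (there y∈))

  allB⁻ : ∀ {p : X → Bool} {xs x} → allB p xs ≡ true → x ∈ xs → p x ≡ true
  allB⁻ {p} {y ∷ _} h (here refl) with p y | h
  ... | true | _ = refl
  allB⁻ {p} {y ∷ _} h (there x∈) with p y | h
  ... | true | h′ = allB⁻ h′ x∈

  allB-false⁻ : ∀ {p : X → Bool} xs → allB p xs ≡ false → ∃[ x ] x ∈ xs × p x ≡ false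
  allB-false⁻ {p} (x ∷ xs) h with p x in px
  ... | false = x , here refl , px
  ... | true with allB-false⁻ xs h
  ...   | y , y∈ , py = y , there y∈ , py

  allB-map : ∀ {Y : Set} (p : Y → Bool) (f : X → Y) xs → allB p (map f xs) ≡ allB (p ∘ f) xs
  allB-map p f []       = refl
  allB-map p f (x ∷ xs) = cong (p (f x) ∧_) (allB-map p f xs)

  []∈sublists : ∀ (xs : List X) → [] ∈ sublists xs
  []∈sublists []       = here refl
  []∈sublists (x ∷ xs) = ∈-++⁺ˡ ([]∈sublists xs)

  filterᵇ∈sublists : ∀ (p : X → Bool) xs → filterᵇ p xs ∈ sublists xs
  filterᵇ∈sublists p []       = here refl
  filterᵇ∈sublists p (x ∷ xs) with p x
  ... | true  = ∈-++⁺ʳ (sublists xs) (∈-map⁺ (x ∷_) (filterᵇ∈sublists p xs))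
  ... | false = ∈-++⁺ˡ (filterᵇ∈sublists p xs)

  sublists-map : ∀ {Y : Set} (f : X → Y) xs → sublists (map f xs) ≡ map (map f) (sublists xs)
  sublists-map f []       = refl
  sublists-map f (x ∷ xs) = begin
    sublists (map f xs) ++ map (f x ∷_) (sublists (map f xs))
      ≡⟨ cong (λ s → s ++ map (f x ∷_) s) (sublists-map f xs) ⟩
    map (map f) (sublists xs) ++ map (f x ∷_) (map (map f) (sublists xs))
      ≡⟨ cong (map (map f) (sublists xs) ++_) (sym (map-∘ (sublists xs))) ⟩
    map (map f) (sublists xs) ++ map (map f ∘ (x ∷_)) (sublists xs)
      ≡⟨ cong (map (map f) (sublists xs) ++_) (map-∘ (sublists xs)) ⟩
    map (map f) (sublists xs) ++ map (map f) (map (x ∷_) (sublists xs))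
      ≡⟨ sym (map-++ (map f) (sublists xs) _) ⟩
    map (map f) (sublists xs ++ map (x ∷_) (sublists xs)) ∎
    where open ≡-Reasoning

maxList-≥ : ∀ {x} xs → x ∈ xs → x ≤ maxList xs
maxList-≥ (y ∷ xs) (here refl) = m≤m⊔n y (maxList xs)
maxList-≥ (y ∷ xs) (there x∈)  = m≤n⇒m≤o⊔n y (maxList-≥ xs x∈)

maxList-attained : ∀ xs → maxList xs ≡ 0 ⊎ maxList xs ∈ xs
maxList-attained []       = inj₁ refl
maxList-attained (y ∷ xs) with ⊔-sel y (maxList xs)
... | inj₁ y⊔≡y = inj₂ (subst (_∈ y ∷ xs) (sym y⊔≡y) (here refl))
... | inj₂ y⊔≡m with maxList-attained xs
...   | inj₁ m≡0 = inj₁ (trans y⊔≡m m≡0)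
...   | inj₂ m∈  = inj₂ (subst (_∈ y ∷ xs) (sym y⊔≡m) (there m∈))

rank-≥ : ∀ {rs s} → s ∈ sublists rs → independent s ≡ true → length s ≤ rank rs
rank-≥ {rs} s∈ ind =
  maxList-≥ _ (∈-map⁺ length (∈-filter⁺ (λ s → T? (independent s)) s∈ (Equivalence.from T-≡ ind)))

rank-attained : ∀ rs → ∃[ s ] s ∈ sublists rs × independent s ≡ true × rank rs ≡ length s
rank-attained rs with maxList-attained (map length (filter (λ s → T? (independent s)) (sublists rs)))
... | inj₁ rank≡0 = [] , []∈sublists rs , refl , rank≡0
... | inj₂ rank∈ with ∈-map⁻ length rank∈
...   | s , s∈ , rank≡ with ∈-filter⁻ (λ s → T? (independent s)) s∈
...     | s∈′ , ind = s , s∈′ , Equivalence.to T-≡ ind , rank≡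

-- Linear combinations of rows over ℤ₂

module _ {X : Set} where

  xorSum : List X → (X → Bool) → Bool
  xorSum []       f = false
  xorSum (x ∷ xs) f = f x xor xorSum xs f

  xorSum-cong : ∀ {f g : X → Bool} xs → (∀ x → f x ≡ g x) → xorSum xs f ≡ xorSum xs g
  xorSum-cong []       f≗g = refl
  xorSum-cong (x ∷ xs) f≗g = cong₂ _xor_ (f≗g x) (xorSum-cong xs f≗g)

  xorSum-zero : ∀ {f : X → Bool} xs → (∀ x → x ∈ xs → f x ≡ false) → xorSum xs f ≡ false
  xorSum-zero []       h = refl
  xorSum-zero (x ∷ xs) h rewrite h x (here refl) = xorSum-zero xs (λ y y∈ → h y (there y∈))

  xorSum-xor : ∀ (f g : X → Bool) xs → xorSum xs (λ x → f x xor g x) ≡ xorSum xs f xor xorSum xs g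
  xorSum-xor f g []       = refl
  xorSum-xor f g (x ∷ xs) rewrite xorSum-xor f g xs = xor-interchange (f x) (g x) (xorSum xs f) (xorSum xs g)

  xorSum-∧ˡ : ∀ e (f : X → Bool) xs → xorSum xs (λ x → e ∧ f x) ≡ e ∧ xorSum xs f
  xorSum-∧ˡ e f []       = sym (∧-zeroʳ e)
  xorSum-∧ˡ e f (x ∷ xs) rewrite xorSum-∧ˡ e f xs = sym (∧-distribˡ-xor e (f x) (xorSum xs f))

  xorSum-point : ∀ {f : X → Bool} {x} xs → Unique xs → x ∈ xs → (∀ y → y ≢ x → f y ≡ false) →
                 xorSum xs f ≡ f x
  xorSum-point {f} (x ∷ xs) (x≢xs ∷ _) (here refl) h =
    trans (cong (f x xor_) (xorSum-zero xs (λ y y∈ → h y (λ y≡x → All.lookup x≢xs y∈ (sym y≡x)))))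
          (xor-identityʳ (f x))
  xorSum-point (y ∷ xs) (y≢xs ∷ u) (there x∈) h
    rewrite h y (All.lookup y≢xs x∈) = xorSum-point xs u x∈ h

  xorSum-filterᵇ : ∀ (p f : X → Bool) xs → xorSum (filterᵇ p xs) f ≡ xorSum xs (λ x → p x ∧ f x)
  xorSum-filterᵇ p f []       = refl
  xorSum-filterᵇ p f (x ∷ xs) with p x
  ... | true  = cong (f x xor_) (xorSum-filterᵇ p f xs)
  ... | false = xorSum-filterᵇ p f xs

-- a mask on row indices serves both as a set of rows and as a coefficient vector
Mask : ℕ → Set
Mask = Vector Bool

_⊆_ : ∀ {n} → Mask n → Mask n → Set
ρ ⊆ σ = ∀ i → ρ i ≡ true → σ i ≡ true

module _ {n : ℕ} where

  ⊆-false : ∀ {ρ σ : Mask n} {i} → ρ ⊆ σ → σ i ≡ false → ρ i ≡ false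
  ⊆-false {ρ} {i = i} ρ⊆σ σi with ρ i in ρi
  ... | true  = ⊥-elim (true≢false (trans (sym (ρ⊆σ i ρi)) σi))
  ... | false = refl

  filterᵇ-accept : ∀ {σ : Mask n} {x} R → σ x ≡ true → filterᵇ σ (x ∷ R) ≡ x ∷ filterᵇ σ R
  filterᵇ-accept R σx rewrite σx = refl

  filterᵇ-reject : ∀ {σ : Mask n} {x} R → σ x ≡ false → filterᵇ σ (x ∷ R) ≡ filterᵇ σ R
  filterᵇ-reject R σx rewrite σx = refl

  filterᵇ-cong : ∀ {σ τ : Mask n} R → (∀ i → i ∈ R → σ i ≡ τ i) →
                 filterᵇ σ R ≡ filterᵇ τ R
  filterᵇ-cong []            h = refl
  filterᵇ-cong {σ} {τ} (x ∷ R) h with σ x | τ x | h x (here refl)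
  ... | true  | .true  | refl = cong (x ∷_) (filterᵇ-cong R (λ i i∈ → h i (there i∈)))
  ... | false | .false | refl = filterᵇ-cong R (λ i i∈ → h i (there i∈))

  filterᵇ-filterᵇ : ∀ (ρ σ : Mask n) R →
                    filterᵇ ρ (filterᵇ σ R) ≡ filterᵇ (λ i → σ i ∧ ρ i) R
  filterᵇ-filterᵇ ρ σ []      = refl
  filterᵇ-filterᵇ ρ σ (x ∷ R) with σ x
  ... | false = filterᵇ-filterᵇ ρ σ R
  ... | true with ρ x
  ...   | true  = cong (x ∷_) (filterᵇ-filterᵇ ρ σ R)
  ...   | false = filterᵇ-filterᵇ ρ σ R

  filterᵇ-⊆ : ∀ {ρ σ : Mask n} R → ρ ⊆ σ → filterᵇ ρ (filterᵇ σ R) ≡ filterᵇ ρ R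
  filterᵇ-⊆ {ρ} {σ} R ρ⊆σ = trans (filterᵇ-filterᵇ ρ σ R) (filterᵇ-cong R σ∧ρ≡ρ)
    where
    σ∧ρ≡ρ : ∀ i → i ∈ R → σ i ∧ ρ i ≡ ρ i
    σ∧ρ≡ρ i _ with ρ i in ρi
    ... | true  = trans (∧-identityʳ (σ i)) (ρ⊆σ i ρi)
    ... | false = ∧-zeroʳ (σ i)

  updateAt-outside : ∀ {x : Fin n} {R i} {f : Bool → Bool} → All (x ≢_) R → (ρ : Mask n) → i ∈ R →
                     updateAt ρ x f i ≡ ρ i
  updateAt-outside {x} {i = i} x≢R ρ i∈ =
    updateAt-minimal i x ρ (λ i≡x → All.lookup x≢R i∈ (sym i≡x))

  sublist⇒filterᵇ : ∀ {L} R → Unique R → L ∈ sublists R → ∃[ ρ ] L ≡ filterᵇ ρ R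
  sublist⇒filterᵇ [] _ (here refl) = const false , refl
  sublist⇒filterᵇ (x ∷ R) (x≢R ∷ uR) L∈ with ∈-++⁻ (sublists R) L∈
  ... | inj₁ L∈R with sublist⇒filterᵇ R uR L∈R
  ...   | ρ , refl = updateAt ρ x (const false) ,
                     sym (trans (filterᵇ-reject R (updateAt-updates x ρ))
                                (filterᵇ-cong R (λ i → updateAt-outside x≢R ρ)))
  sublist⇒filterᵇ (x ∷ R) (x≢R ∷ uR) L∈ | inj₂ L∈xR with ∈-map⁻ (x ∷_) L∈xR
  ... | L′ , L′∈ , refl with sublist⇒filterᵇ R uR L′∈
  ...   | ρ , refl = updateAt ρ x (const true) ,
                     sym (trans (filterᵇ-accept R (updateAt-updates x ρ))
                                (cong (x ∷_) (filterᵇ-cong R (λ i → updateAt-outside x≢R ρ))))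

  xorSum-indicator : ∀ {x} (f : Fin n → Bool) R → Unique R → x ∈ R →
                     xorSum R (λ i → eqB i x ∧ f i) ≡ f x
  xorSum-indicator {x} f R u x∈ =
    trans (xorSum-point R u x∈ (λ y y≢x → cong (_∧ f y) (eqB-≢ y≢x))) (cong (_∧ f x) (eqB-refl x))

  length-filterᵇ-insert : ∀ {σ τ : Mask n} {x} R → Unique R → x ∈ R →
                          σ x ≡ false → τ x ≡ true → (∀ i → i ≢ x → τ i ≡ σ i) →
                          length (filterᵇ τ R) ≡ suc (length (filterᵇ σ R))
  length-filterᵇ-insert {σ} {τ} (x ∷ R) (x≢R ∷ _) (here refl) σx τx τ≐σ
    rewrite filterᵇ-accept {σ = τ} R τx | filterᵇ-reject {σ = σ} R σx =
      cong (suc ∘ length) (filterᵇ-cong R (λ i i∈ → τ≐σ i (λ i≡x → All.lookup x≢R i∈ (sym i≡x))))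
  length-filterᵇ-insert {σ} {τ} (y ∷ R) (y≢R ∷ u) (there x∈) σx τx τ≐σ with σ y in σy
  ... | true  rewrite filterᵇ-accept {σ = τ} R (trans (τ≐σ y (All.lookup y≢R x∈)) σy) =
    cong suc (length-filterᵇ-insert R u x∈ σx τx τ≐σ)
  ... | false rewrite filterᵇ-reject {σ = τ} R (trans (τ≐σ y (All.lookup y≢R x∈)) σy) =
    length-filterᵇ-insert R u x∈ σx τx τ≐σ

rows : ∀ {n} → Adj n → List (Fin n) → List (Fin n) → List (List Bool)
rows F C R = map (λ i → map (F i) C) R

module _ {n : ℕ} where

  rows-cong : ∀ {F G : Adj n} C R → (∀ i c → F i c ≡ G i c) → rows F C R ≡ rows G C R
  rows-cong C R F≗G = map-cong (λ i → map-cong (F≗G i) C) R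

  addV-map : ∀ (C : List (Fin n)) f g → addV (map f C) (map g C) ≡ map (λ c → f c xor g c) C
  addV-map []      f g = refl
  addV-map (c ∷ C) f g = cong ((f c xor g c) ∷_) (addV-map C f g)

  addV-sumV-rows : ∀ (F : Adj n) C L g →
                   addV (map g C) (sumV (rows F C L)) ≡ map (λ c → g c xor xorSum L (λ i → F i c)) C
  addV-sumV-rows F []      []      g = refl
  addV-sumV-rows F (c ∷ C) []      g = map-cong (λ c → sym (xor-identityʳ (g c))) (c ∷ C)
  addV-sumV-rows F C       (x ∷ L) g = begin
    addV (map g C) (addV (map (F x) C) (sumV (rows F C L)))
      ≡⟨ cong (addV (map g C)) (addV-sumV-rows F C L (F x)) ⟩
    addV (map g C) (map (λ c → xorSum (x ∷ L) (λ i → F i c)) C)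
      ≡⟨ addV-map C g _ ⟩
    map (λ c → g c xor xorSum (x ∷ L) (λ i → F i c)) C ∎
    where open ≡-Reasoning

  isZeroV-zeros : ∀ (C : List (Fin n)) → isZeroV (map (const false) C) ≡ true
  isZeroV-zeros []      = refl
  isZeroV-zeros (c ∷ C) = isZeroV-zeros C

  isZeroV-zeros-addV : ∀ (C : List (Fin n)) v → isZeroV (addV (map (const false) C) v) ≡ isZeroV v
  isZeroV-zeros-addV []      v       = refl
  isZeroV-zeros-addV (c ∷ C) []      = isZeroV-zeros C
  isZeroV-zeros-addV (c ∷ C) (x ∷ v) = cong (not x ∧_) (isZeroV-zeros-addV C v)

  isZeroV-sumV-rows : ∀ (F : Adj n) C L →
                      isZeroV (sumV (rows F C L)) ≡ allB (λ c → not (xorSum L (λ i → F i c))) C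
  isZeroV-sumV-rows F C L = begin
    isZeroV (sumV (rows F C L))                               ≡⟨ sym (isZeroV-zeros-addV C _) ⟩
    isZeroV (addV (map (const false) C) (sumV (rows F C L)))
      ≡⟨ cong isZeroV (addV-sumV-rows F C L (const false)) ⟩
    isZeroV (map (λ c → xorSum L (λ i → F i c)) C)            ≡⟨ allB-map not _ C ⟩
    allB (λ c → not (xorSum L (λ i → F i c))) C               ∎
    where open ≡-Reasoning

  lincomb : Adj n → List (Fin n) → Mask n → Fin n → Bool
  lincomb F R ρ c = xorSum R (λ i → ρ i ∧ F i c)

  NonTrivial : List (Fin n) → Mask n → Set
  NonTrivial R ρ = ∃[ i ] i ∈ R × ρ i ≡ true

  Vanishes : Adj n → List (Fin n) → List (Fin n) → Mask n → Set
  Vanishes F C R ρ = ∀ c → c ∈ C → lincomb F R ρ c ≡ false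

  IsRelation : Adj n → List (Fin n) → List (Fin n) → Mask n → Set
  IsRelation F C R ρ = NonTrivial R ρ × Vanishes F C R ρ

  Independent : Adj n → List (Fin n) → List (Fin n) → Mask n → Set
  Independent F C R σ = ∀ ρ → ρ ⊆ σ → ¬ IsRelation F C R ρ

  lincomb-xor : ∀ (F : Adj n) R (ρ τ : Mask n) c →
                lincomb F R (λ i → ρ i xor τ i) c ≡ lincomb F R ρ c xor lincomb F R τ c
  lincomb-xor F R ρ τ c =
    trans (xorSum-cong R (λ i → ∧-distribʳ-xor (F i c) (ρ i) (τ i))) (xorSum-xor _ _ R)

  rows-∈-sublists : ∀ (F : Adj n) C {L} R → L ∈ sublists R → rows F C L ∈ sublists (rows F C R)
  rows-∈-sublists F C R L∈ = subst (_ ∈_) (sym (sublists-map (λ i → map (F i) C) R)) (∈-map⁺ _ L∈)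

  sublists-rows⁻ : ∀ (F : Adj n) C {t} R → t ∈ sublists (rows F C R) →
                   ∃[ L ] L ∈ sublists R × t ≡ rows F C L
  sublists-rows⁻ F C R t∈ = ∈-map⁻ _ (subst (_ ∈_) (sublists-map (λ i → map (F i) C) R) t∈)

  module _ (F : Adj n) (C R : List (Fin n)) where

    nonEmpty-rows⁺ : ∀ {ρ} → NonTrivial R ρ → nonEmpty (rows F C (filterᵇ ρ R)) ≡ true
    nonEmpty-rows⁺ (i , i∈ , ρi) =
      ∈-nonEmpty (∈-map⁺ (λ i → map (F i) C) (∈-filter⁺ (T? ∘ _) i∈ (Equivalence.from T-≡ ρi)))

    nonEmpty-rows⁻ : ∀ {ρ} → nonEmpty (rows F C (filterᵇ ρ R)) ≡ true → NonTrivial R ρ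
    nonEmpty-rows⁻ {ρ} ne with nonEmpty-∈ _ ne
    ... | _ , r∈ with ∈-map⁻ (λ i → map (F i) C) r∈
    ...   | i , i∈ , _ with ∈-filter⁻ (T? ∘ ρ) i∈
    ...     | i∈R , ρi = i , i∈R , Equivalence.to T-≡ ρi

    isZeroV-rows⁺ : ∀ {ρ} → Vanishes F C R ρ → isZeroV (sumV (rows F C (filterᵇ ρ R))) ≡ true
    isZeroV-rows⁺ {ρ} van = trans (isZeroV-sumV-rows F C (filterᵇ ρ R))
      (allB⁺ C (λ c c∈ → cong not (trans (xorSum-filterᵇ ρ (λ i → F i c) R) (van c c∈))))

    isZeroV-rows⁻ : ∀ {ρ} → isZeroV (sumV (rows F C (filterᵇ ρ R))) ≡ true → Vanishes F C R ρ
    isZeroV-rows⁻ {ρ} z c c∈ = not-injective (trans (sym (cong not (xorSum-filterᵇ ρ (λ i → F i c) R)))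
      (allB⁻ (trans (sym (isZeroV-sumV-rows F C (filterᵇ ρ R))) z) c∈))

    independent-sound : ∀ {σ} → independent (rows F C (filterᵇ σ R)) ≡ true → Independent F C R σ
    independent-sound {σ} ind ρ ρ⊆σ (nt , van)
      with subst₂ (λ x y → not (x ∧ y) ≡ true) (nonEmpty-rows⁺ nt) (isZeroV-rows⁺ van) (allB⁻ ind ρ∈)
      where
      ρ∈ : rows F C (filterᵇ ρ R) ∈ sublists (rows F C (filterᵇ σ R))
      ρ∈ = subst (λ L → rows F C L ∈ sublists (rows F C (filterᵇ σ R))) (filterᵇ-⊆ R ρ⊆σ)
             (rows-∈-sublists F C (filterᵇ σ R) (filterᵇ∈sublists ρ (filterᵇ σ R)))
    ... | ()

    relation-witness : ∀ {σ} → Unique R → independent (rows F C (filterᵇ σ R)) ≡ false →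
                       ∃[ ρ ] ρ ⊆ σ × IsRelation F C R ρ
    relation-witness {σ} u dep with allB-false⁻ (sublists (rows F C (filterᵇ σ R))) dep
    ... | t , t∈ , ¬ok with sublists-rows⁻ F C (filterᵇ σ R) t∈
    ...   | L , L∈ , refl with sublist⇒filterᵇ (filterᵇ σ R) (Unique.filter⁺ (T? ∘ σ) u) L∈
    ...     | ρ , refl =
      σ∧ρ , (λ i → ∧-conicalˡ (σ i) (ρ i)) ,
      nonEmpty-rows⁻ (∧-conicalˡ _ _ ne∧z) , isZeroV-rows⁻ (∧-conicalʳ _ _ ne∧z)
      where
      σ∧ρ : Mask n
      σ∧ρ i = σ i ∧ ρ i
      ne∧z : nonEmpty (rows F C (filterᵇ σ∧ρ R)) ∧ isZeroV (sumV (rows F C (filterᵇ σ∧ρ R))) ≡ true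
      ne∧z = subst (λ L → nonEmpty (rows F C L) ∧ isZeroV (sumV (rows F C L)) ≡ true)
                   (filterᵇ-filterᵇ ρ σ R) (not-injective ¬ok)

    independent-or-relation : Unique R → ∀ σ →
                              Independent F C R σ ⊎ ∃[ ρ ] ρ ⊆ σ × IsRelation F C R ρ
    independent-or-relation u σ with independent (rows F C (filterᵇ σ R)) in ind
    ... | true  = inj₁ (independent-sound ind)
    ... | false = inj₂ (relation-witness u ind)

    independent-complete : ∀ {σ} → Unique R → Independent F C R σ →
                           independent (rows F C (filterᵇ σ R)) ≡ true
    independent-complete {σ} u ind with independent (rows F C (filterᵇ σ R)) in dep
    ... | true  = refl
    ... | false with relation-witness u dep
    ...   | ρ , ρ⊆σ , rel = ⊥-elim (ind ρ ρ⊆σ rel)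

    rank-≥-independent : ∀ {σ} → Unique R → Independent F C R σ →
                         length (filterᵇ σ R) ≤ rank (rows F C R)
    rank-≥-independent {σ} u ind = subst (_≤ rank (rows F C R)) (length-map _ (filterᵇ σ R))
      (rank-≥ {rows F C R} (rows-∈-sublists F C R (filterᵇ∈sublists σ R)) (independent-complete u ind))

    rank-attained-by-mask : Unique R →
                            ∃[ σ ] Independent F C R σ × rank (rows F C R) ≡ length (filterᵇ σ R)
    rank-attained-by-mask u with rank-attained (rows F C R)
    ... | s , s∈ , ind , rank≡ with sublists-rows⁻ F C R s∈
    ...   | L , L∈ , refl with sublist⇒filterᵇ R u L∈
    ...     | σ , refl = σ , independent-sound ind , trans rank≡ (length-map _ (filterᵇ σ R))

  module _ {F G : Adj n} {C R : List (Fin n)} (u : Unique R) where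

    rank-≤-by-exchange :
      (∀ σ → Independent F C R σ →
             ∃[ σ′ ] Independent G C R σ′ × length (filterᵇ σ R) ≤ length (filterᵇ σ′ R)) →
      rank (rows F C R) ≤ rank (rows G C R)
    rank-≤-by-exchange transfer with rank-attained-by-mask F C R u
    ... | σ , indF , rank≡ with transfer σ indF
    ...   | σ′ , indG , σ≤σ′ =
      ≤-trans (≤-reflexive rank≡) (≤-trans σ≤σ′ (rank-≥-independent G C R u indG))

    rank-≤-by-relations : (∀ ρ → Vanishes G C R ρ → Vanishes F C R ρ) →
                          rank (rows F C R) ≤ rank (rows G C R)
    rank-≤-by-relations G⇒F =
      rank-≤-by-exchange (λ σ ind → σ , (λ ρ ρ⊆σ (nt , van) → ind ρ ρ⊆σ (nt , G⇒F ρ van)) , ≤-refl)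

-- Elementary row and column operations

module _ {n : ℕ} where

  addCol : Fin n → Fin n → Adj n → Adj n
  addCol a b F i c = F i c xor (eqB c a ∧ F i b)

  addRow : Fin n → Fin n → Adj n → Adj n
  addRow a b F i c = F i c xor (eqB i a ∧ F b c)

  -- ρ ↦ ρ E for the elementary matrix E with addRow a b F = E F
  addEntry : Fin n → Fin n → Mask n → Mask n
  addEntry a b ρ i = ρ i xor (eqB i b ∧ ρ a)

  exchange : Fin n → Fin n → Mask n → Mask n
  exchange a b σ = updateAt (updateAt σ a (const false)) b (const true)

module _ {n : ℕ} {a b : Fin n} where

  addEntry-other : ∀ ρ {i} → i ≢ b → addEntry a b ρ i ≡ ρ i
  addEntry-other ρ {i} i≢b = trans (cong (λ z → ρ i xor (z ∧ ρ a)) (eqB-≢ i≢b)) (xor-identityʳ (ρ i))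

  addEntry-at-b : ∀ ρ → addEntry a b ρ b ≡ ρ b xor ρ a
  addEntry-at-b ρ = cong (λ z → ρ b xor (z ∧ ρ a)) (eqB-refl b)

  addEntry-unused : ∀ {ρ} → ρ a ≡ false → ∀ i → addEntry a b ρ i ≡ ρ i
  addEntry-unused {ρ} ρa i =
    trans (cong (λ z → ρ i xor (eqB i b ∧ z)) ρa)
          (trans (cong (ρ i xor_) (∧-zeroʳ _)) (xor-identityʳ (ρ i)))

  addEntry-⊆ : ∀ {ρ σ} → ρ ⊆ σ → (ρ a ≡ true → σ b ≡ true) → addEntry a b ρ ⊆ σ
  addEntry-⊆ {ρ} ρ⊆σ ρa⇒σb i e with i ≟ b
  ... | no _     = ρ⊆σ i (trans (sym (xor-identityʳ (ρ i))) e)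
  ... | yes refl with xor-true e
  ...   | inj₁ ρb = ρ⊆σ b ρb
  ...   | inj₂ ρa = ρa⇒σb ρa

  exchange-other : ∀ σ {i} → i ≢ a → i ≢ b → exchange a b σ i ≡ σ i
  exchange-other σ {i} i≢a i≢b = trans (updateAt-minimal i b _ i≢b) (updateAt-minimal i a σ i≢a)

  ⊆-exchange : ∀ {σ τ} → σ a ≡ true → τ ⊆ exchange a b σ →
               ∀ i → i ≢ b → τ i ≡ true → σ i ≡ true
  ⊆-exchange {σ} σa τ⊆ i i≢b τi with i ≟ a
  ... | yes refl = σa
  ... | no i≢a   = trans (sym (exchange-other σ i≢a i≢b)) (τ⊆ i τi)

module _ {n : ℕ} {a b : Fin n} (a≢b : a ≢ b) where

  addCol-at-b : ∀ F i → addCol a b F i b ≡ F i b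
  addCol-at-b F i = trans (cong (λ z → F i b xor (z ∧ F i b)) (eqB-≢ (a≢b ∘ sym))) (xor-identityʳ (F i b))

  addRow-at-b : ∀ F c → addRow a b F b c ≡ F b c
  addRow-at-b F c = trans (cong (λ z → F b c xor (z ∧ F b c)) (eqB-≢ (a≢b ∘ sym))) (xor-identityʳ (F b c))

  addRow-involutive : ∀ F i c → addRow a b (addRow a b F) i c ≡ F i c
  addRow-involutive F i c =
    trans (cong (λ z → addRow a b F i c xor (eqB i a ∧ z)) (addRow-at-b F c)) (xor-cancelʳ (F i c) _)

  exchange-at-a : ∀ σ → exchange a b σ a ≡ false
  exchange-at-a σ = trans (updateAt-minimal a b _ a≢b) (updateAt-updates a σ)

  length-exchange : ∀ {σ} R → Unique R → a ∈ R → b ∈ R → σ a ≡ true → σ b ≡ false →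
                    length (filterᵇ (exchange a b σ) R) ≡ length (filterᵇ σ R)
  length-exchange {σ} R u a∈ b∈ σa σb = trans
    (length-filterᵇ-insert R u b∈ (trans (updateAt-minimal b a σ (a≢b ∘ sym)) σb) (updateAt-updates b _)
                           (λ i → updateAt-minimal i b _))
    (sym (length-filterᵇ-insert R u a∈ (updateAt-updates a σ) σa
                                (λ i i≢a → sym (updateAt-minimal i a σ i≢a))))

module _ {n : ℕ} {a b : Fin n} (a≢b : a ≢ b) {C R : List (Fin n)} (u : Unique R) (b∈C : b ∈ C) where

  lincomb-addCol : ∀ F ρ c →
                   lincomb (addCol a b F) R ρ c ≡ lincomb F R ρ c xor (eqB c a ∧ lincomb F R ρ b)
  lincomb-addCol F ρ c = begin
    xorSum R (λ i → ρ i ∧ (F i c xor (eqB c a ∧ F i b)))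
      ≡⟨ xorSum-cong R (λ i → ∧-distribˡ-xor-∧ (ρ i) (F i c) (eqB c a) (F i b)) ⟩
    xorSum R (λ i → (ρ i ∧ F i c) xor (eqB c a ∧ (ρ i ∧ F i b)))
      ≡⟨ xorSum-xor _ _ R ⟩
    lincomb F R ρ c xor xorSum R (λ i → eqB c a ∧ (ρ i ∧ F i b))
      ≡⟨ cong (lincomb F R ρ c xor_) (xorSum-∧ˡ (eqB c a) _ R) ⟩
    lincomb F R ρ c xor (eqB c a ∧ lincomb F R ρ b) ∎
    where open ≡-Reasoning

  lincomb-addCol-at-b : ∀ F ρ → lincomb (addCol a b F) R ρ b ≡ lincomb F R ρ b
  lincomb-addCol-at-b F ρ = xorSum-cong R (λ i → cong (ρ i ∧_) (addCol-at-b a≢b F i))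

  vanishes-addCol⁺ : ∀ {F ρ} → Vanishes F C R ρ → Vanishes (addCol a b F) C R ρ
  vanishes-addCol⁺ {F} {ρ} van c c∈ = begin
    lincomb (addCol a b F) R ρ c                      ≡⟨ lincomb-addCol F ρ c ⟩
    lincomb F R ρ c xor (eqB c a ∧ lincomb F R ρ b)
      ≡⟨ cong₂ (λ x y → x xor (eqB c a ∧ y)) (van c c∈) (van b b∈C) ⟩
    eqB c a ∧ false                                   ≡⟨ ∧-zeroʳ (eqB c a) ⟩
    false                                             ∎
    where open ≡-Reasoning

  vanishes-addCol⁻ : ∀ {F ρ} → Vanishes (addCol a b F) C R ρ → Vanishes F C R ρ
  vanishes-addCol⁻ {F} {ρ} van c c∈ = begin
    lincomb F R ρ c
      ≡⟨ sym (xor-cancelʳ _ _) ⟩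
    (lincomb F R ρ c xor (eqB c a ∧ lincomb F R ρ b)) xor (eqB c a ∧ lincomb F R ρ b)
      ≡⟨ cong₂ (λ x y → x xor (eqB c a ∧ y)) (trans (sym (lincomb-addCol F ρ c)) (van c c∈))
                                              (trans (sym (lincomb-addCol-at-b F ρ)) (van b b∈C)) ⟩
    eqB c a ∧ false
      ≡⟨ ∧-zeroʳ (eqB c a) ⟩
    false ∎
    where open ≡-Reasoning

  rank-addCol : ∀ F → rank (rows (addCol a b F) C R) ≡ rank (rows F C R)
  rank-addCol F = ≤-antisym (rank-≤-by-relations u (λ ρ → vanishes-addCol⁺ {F} {ρ}))
                            (rank-≤-by-relations u (λ ρ → vanishes-addCol⁻ {F} {ρ}))

module _ {n : ℕ} {a b : Fin n} (a≢b : a ≢ b) {R : List (Fin n)} (u : Unique R) (a∈R : a ∈ R) (b∈R : b ∈ R)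
         where

  lincomb-addRow : ∀ F ρ c → lincomb (addRow a b F) R ρ c ≡ lincomb F R ρ c xor (ρ a ∧ F b c)
  lincomb-addRow F ρ c = begin
    xorSum R (λ i → ρ i ∧ (F i c xor (eqB i a ∧ F b c)))
      ≡⟨ xorSum-cong R (λ i → ∧-distribˡ-xor-∧ (ρ i) (F i c) (eqB i a) (F b c)) ⟩
    xorSum R (λ i → (ρ i ∧ F i c) xor (eqB i a ∧ (ρ i ∧ F b c)))
      ≡⟨ xorSum-xor _ _ R ⟩
    lincomb F R ρ c xor xorSum R (λ i → eqB i a ∧ (ρ i ∧ F b c))
      ≡⟨ cong (lincomb F R ρ c xor_) (xorSum-indicator (λ i → ρ i ∧ F b c) R u a∈R) ⟩
    lincomb F R ρ c xor (ρ a ∧ F b c) ∎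
    where open ≡-Reasoning

  lincomb-addEntry : ∀ F ρ c → lincomb F R (addEntry a b ρ) c ≡ lincomb F R ρ c xor (ρ a ∧ F b c)
  lincomb-addEntry F ρ c = begin
    xorSum R (λ i → (ρ i xor (eqB i b ∧ ρ a)) ∧ F i c)
      ≡⟨ xorSum-cong R (λ i → trans (∧-distribʳ-xor (F i c) (ρ i) _)
                                    (cong ((ρ i ∧ F i c) xor_) (∧-assoc (eqB i b) (ρ a) (F i c)))) ⟩
    xorSum R (λ i → (ρ i ∧ F i c) xor (eqB i b ∧ (ρ a ∧ F i c)))
      ≡⟨ xorSum-xor _ _ R ⟩
    lincomb F R ρ c xor xorSum R (λ i → eqB i b ∧ (ρ a ∧ F i c))
      ≡⟨ cong (lincomb F R ρ c xor_) (xorSum-indicator (λ i → ρ a ∧ F i c) R u b∈R) ⟩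
    lincomb F R ρ c xor (ρ a ∧ F b c) ∎
    where open ≡-Reasoning

  nonTrivial-addEntry : ∀ {ρ} → NonTrivial R ρ → NonTrivial R (addEntry a b ρ)
  nonTrivial-addEntry {ρ} (i , i∈ , ρi) = by-ρa (ρ a) refl
    where
    by-ρa : ∀ v → ρ a ≡ v → NonTrivial R (addEntry a b ρ)
    by-ρa true  ρa = a , a∈R , trans (addEntry-other ρ a≢b) ρa
    by-ρa false ρa = i , i∈ , trans (addEntry-unused {ρ = ρ} ρa i) ρi

  module _ (F : Adj n) (C : List (Fin n)) where

    vanishes-addEntry : ∀ {ρ} → Vanishes (addRow a b F) C R ρ → Vanishes F C R (addEntry a b ρ)
    vanishes-addEntry {ρ} van c c∈ =
      trans (lincomb-addEntry F ρ c) (trans (sym (lincomb-addRow F ρ c)) (van c c∈))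

    vanishes-addRow-unused : ∀ {ρ} → ρ a ≡ false → Vanishes (addRow a b F) C R ρ → Vanishes F C R ρ
    vanishes-addRow-unused {ρ} ρa van c c∈ = begin
      lincomb F R ρ c                      ≡⟨ sym (xor-identityʳ _) ⟩
      lincomb F R ρ c xor false            ≡⟨ cong (λ z → lincomb F R ρ c xor (z ∧ F b c)) (sym ρa) ⟩
      lincomb F R ρ c xor (ρ a ∧ F b c)    ≡⟨ sym (lincomb-addRow F ρ c) ⟩
      lincomb (addRow a b F) R ρ c         ≡⟨ van c c∈ ⟩
      false                                ∎
      where open ≡-Reasoning

    -- If ρ is a relation of addRow a b F inside σ using row a, then a can be traded for b:
    -- any relation τ inside the exchanged set uses b, and ρ E + τ is then a relation of F inside σ.
    exchange-independent : ∀ {σ ρ} → Independent F C R σ → σ a ≡ true → σ b ≡ false →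
                           ρ ⊆ σ → ρ a ≡ true → Vanishes (addRow a b F) C R ρ →
                           Independent (addRow a b F) C R (exchange a b σ)
    exchange-independent {σ} {ρ} indF σa σb ρ⊆σ ρa vanρ τ τ⊆ (ntτ , vanτ) = by-τb (τ b) refl
      where
      τa : τ a ≡ false
      τa = ⊆-false τ⊆ (exchange-at-a a≢b σ)
      vanFτ : Vanishes F C R τ
      vanFτ = vanishes-addRow-unused τa vanτ
      μ : Mask n
      μ i = addEntry a b ρ i xor τ i
      μ-relation : IsRelation F C R μ
      μ-relation = (a , a∈R , cong₂ _xor_ (trans (addEntry-other ρ a≢b) ρa) τa) ,
                   λ c c∈ → trans (lincomb-xor F R (addEntry a b ρ) τ c)
                                  (cong₂ _xor_ (vanishes-addEntry vanρ c c∈) (vanFτ c c∈))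
      μ⊆σ : τ b ≡ true → μ ⊆ σ
      μ⊆σ τb i μi = by-i≟b (i ≟ b)
        where
        μb : μ b ≡ false
        μb = cong₂ _xor_ (trans (addEntry-at-b ρ) (cong₂ _xor_ (⊆-false ρ⊆σ σb) ρa)) τb
        by-i≟b : Dec (i ≡ b) → σ i ≡ true
        by-i≟b (yes refl) = ⊥-elim (true≢false (trans (sym μi) μb))
        by-i≟b (no i≢b) with xor-true (trans (sym (cong (_xor τ i) (addEntry-other ρ i≢b))) μi)
        ... | inj₁ ρi = ρ⊆σ i ρi
        ... | inj₂ τi = ⊆-exchange σa τ⊆ i i≢b τi
      by-τb : ∀ v → τ b ≡ v → ⊥
      by-τb false τb = indF τ (λ i τi → ⊆-exchange σa τ⊆ i (λ { refl → true≢false (trans (sym τi) τb) }) τi)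
                              (ntτ , vanFτ)
      by-τb true  τb = indF μ (μ⊆σ τb) μ-relation

    addRow-exchange : ∀ σ → Independent F C R σ →
                      ∃[ σ′ ] Independent (addRow a b F) C R σ′ ×
                              length (filterᵇ σ R) ≤ length (filterᵇ σ′ R)
    addRow-exchange σ indF with independent-or-relation (addRow a b F) C R u σ
    ... | inj₁ indG = σ , indG , ≤-refl
    ... | inj₂ (ρ , ρ⊆σ , nt , van) with ρ a in ρa | σ b in σb
    ...   | true | false = exchange a b σ , exchange-independent indF (ρ⊆σ a ρa) σb ρ⊆σ ρa van ,
                           ≤-reflexive (sym (length-exchange a≢b R u a∈R b∈R (ρ⊆σ a ρa) σb))
    ...   | true | true = ⊥-elim (indF (addEntry a b ρ) (addEntry-⊆ ρ⊆σ (λ _ → σb))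
                                      (nonTrivial-addEntry nt , vanishes-addEntry van))
    ...   | false | _ = ⊥-elim (indF (addEntry a b ρ)
                                   (addEntry-⊆ ρ⊆σ (λ ρa′ → ⊥-elim (true≢false (trans (sym ρa′) ρa))))
                                   (nonTrivial-addEntry nt , vanishes-addEntry van))

  rank-addRow : ∀ F C → rank (rows (addRow a b F) C R) ≡ rank (rows F C R)
  rank-addRow F C = ≤-antisym
    (≤-trans (rank-≤-by-exchange u (addRow-exchange (addRow a b F) C))
             (≤-reflexive (cong rank (rows-cong C R (addRow-involutive a≢b F)))))
    (rank-≤-by-exchange u (addRow-exchange F C))

-- The graph operations on principal submatrices

if-not≡xor : ∀ c m → (if c then not m else m) ≡ c xor m
if-not≡xor true  m = refl
if-not≡xor false m = refl

eqB-∧-false : ∀ {n} {i j x y : Fin n} → ¬ (i ≡ x × j ≡ y) → eqB i x ∧ eqB j y ≡ false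
eqB-∧-false {i = i} {j} {x} {y} h with i ≟ x | j ≟ y
... | yes i≡x | yes j≡y = ⊥-elim (h (i≡x , j≡y))
... | yes _   | no _    = refl
... | no _    | _       = refl

module _ {n : ℕ} where

  elems-unique : ∀ (S : Vec Bool n) → Unique (elems S)
  elems-unique S = Unique.filter⁺ (T? ∘ lookup S) (Unique.allFin⁺ n)

  ∈-elems⁺ : ∀ (S : Vec Bool n) {i} → lookup S i ≡ true → i ∈ elems S
  ∈-elems⁺ S {i} Si = ∈-filter⁺ (T? ∘ lookup S) (∈-allFin i) (Equivalence.from T-≡ Si)

  ∈-elems⁻ : ∀ (S : Vec Bool n) {i} → i ∈ elems S → lookup S i ≡ true
  ∈-elems⁻ S i∈ = Equivalence.to T-≡ (proj₂ (∈-filter⁻ (T? ∘ lookup S) {xs = allFin n} i∈))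

  principal-cong : ∀ {X Y : Adj n} S →
                   (∀ i j → lookup S i ≡ true → lookup S j ≡ true → X i j ≡ Y i j) →
                   principal X S ≡ principal Y S
  principal-cong S X≐Y = map-cong-local (All.tabulate (λ i∈ →
    map-cong-local (All.tabulate (λ j∈ → X≐Y _ _ (∈-elems⁻ S i∈) (∈-elems⁻ S j∈)))))

  exponent : Adj n → Vec Bool n → ℕ
  exponent X A = rank (principal X A) + rank (principal X (complement A))

  exponent-cong : ∀ {X Y : Adj n} → (∀ i j → X i j ≡ Y i j) → ∀ A → exponent X A ≡ exponent Y A
  exponent-cong X≗Y A = cong₂ _+_ (cong rank (rows-cong (elems A) (elems A) X≗Y))
                                  (cong rank (rows-cong (elems (complement A)) (elems (complement A)) X≗Y))

module _ {n : ℕ} {a b : Fin n} where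

  toggleAB-outside : ∀ (X : Adj n) {i j} → ¬ (i ≡ a × j ≡ b) → ¬ (i ≡ b × j ≡ a) →
                     toggleAB a b X i j ≡ X i j
  toggleAB-outside X {i} {j} ¬ab ¬ba
    rewrite eqB-∧-false {i = i} {j} ¬ab | eqB-∧-false {i = i} {j} ¬ba = refl

  tildeAB-outside : ∀ (X : Adj n) {i j} → i ≢ a → j ≢ a → tildeAB a b X i j ≡ X i j
  tildeAB-outside X i≢a j≢a rewrite eqB-≢ i≢a | eqB-≢ j≢a = refl

  principal-toggleAB : ∀ (X : Adj n) S → lookup S a ≢ lookup S b →
                       principal (toggleAB a b X) S ≡ principal X S
  principal-toggleAB X S Sa≢Sb = principal-cong S (λ i j Si Sj → toggleAB-outside X
    (λ { (refl , refl) → Sa≢Sb (trans Si (sym Sj)) })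
    (λ { (refl , refl) → Sa≢Sb (trans Sj (sym Si)) }))

  principal-tildeAB-∌ : ∀ (X : Adj n) S → lookup S a ≡ false → principal (tildeAB a b X) S ≡ principal X S
  principal-tildeAB-∌ X S Sa = principal-cong S (λ i j Si Sj → tildeAB-outside X
    (λ { refl → true≢false (trans (sym Si) Sa) })
    (λ { refl → true≢false (trans (sym Sj) Sa) }))

module _ {n : ℕ} {a b : Fin n} (a≢b : a ≢ b) where

  toggleAB-simple : ∀ {M : Adj n} → IsSimpleGraph M → IsSimpleGraph (toggleAB a b M)
  toggleAB-simple {M} (M-sym , M-irrefl) = toggle-sym , toggle-irrefl
    where
    toggle-sym : ∀ i j → toggleAB a b M i j ≡ toggleAB a b M j i
    toggle-sym i j = cong₂ (λ c m → if c then not m else m)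
      (trans (∨-comm (eqB i a ∧ eqB j b) (eqB i b ∧ eqB j a))
             (cong₂ _∨_ (∧-comm (eqB i b) (eqB j a)) (∧-comm (eqB i a) (eqB j b))))
      (M-sym i j)
    toggle-irrefl : ∀ i → toggleAB a b M i i ≡ false
    toggle-irrefl i = trans (toggleAB-outside M (λ (i≡a , i≡b) → a≢b (trans (sym i≡a) i≡b))
                                                (λ (i≡b , i≡a) → a≢b (trans (sym i≡a) i≡b)))
                            (M-irrefl i)

  tildeAB-toggleAB : ∀ (M : Adj n) i j → tildeAB' a b M i j ≡ tildeAB a b (toggleAB a b M) i j
  tildeAB-toggleAB M i j = begin
    toggleAB a b (tildeAB a b M) i j   ≡⟨ if-not≡xor t _ ⟩
    t xor tildeAB a b M i j            ≡⟨ cong (t xor_) (if-not≡xor (d M) _) ⟩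
    t xor (d M xor M i j)              ≡⟨ xor-left-comm t (d M) (M i j) ⟩
    d M xor (t xor M i j)              ≡⟨ cong₂ _xor_ d-toggle (sym (if-not≡xor t _)) ⟩
    d (toggleAB a b M) xor toggleAB a b M i j   ≡⟨ sym (if-not≡xor (d (toggleAB a b M)) _) ⟩
    tildeAB a b (toggleAB a b M) i j   ∎
    where
    open ≡-Reasoning
    t : Bool
    t = (eqB i a ∧ eqB j b) ∨ (eqB i b ∧ eqB j a)
    d : Adj n → Bool
    d X = (eqB i a ∧ not (eqB j a) ∧ X b j) ∨ (eqB j a ∧ not (eqB i a) ∧ X b i)
    -- row b of M changes only in column a, which the condition d ignores
    row-b : ∀ x → not (eqB x a) ∧ toggleAB a b M b x ≡ not (eqB x a) ∧ M b x
    row-b x = by-x≟a (x ≟ a)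
      where
      by-x≟a : Dec (x ≡ a) → not (eqB x a) ∧ toggleAB a b M b x ≡ not (eqB x a) ∧ M b x
      by-x≟a (yes refl) = trans (cong (λ z → not z ∧ toggleAB a b M b a) (eqB-refl a))
                                (sym (cong (λ z → not z ∧ M b a) (eqB-refl a)))
      by-x≟a (no x≢a)   = cong (not (eqB x a) ∧_)
                            (toggleAB-outside M (λ (b≡a , _) → a≢b (sym b≡a)) (λ (_ , x≡a) → x≢a x≡a))
    d-toggle : d M ≡ d (toggleAB a b M)
    d-toggle = sym (cong₂ _∨_ (cong (eqB i a ∧_) (row-b j)) (cong (eqB j a ∧_) (row-b i)))

  tildeAB-elementary : ∀ {M : Adj n} → IsSimpleGraph M → ∀ i j →
                       tildeAB a b M i j ≡ addRow a b (addCol a b M) i j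
  tildeAB-elementary {M} (M-sym , M-irrefl) i j with i ≟ a | j ≟ a
  ... | yes refl | yes refl rewrite M-sym b a | M-irrefl b = at-aa (M a a) (M a b)
    where
    at-aa : ∀ x y → x ≡ (x xor y) xor (y xor false)
    at-aa x y = sym (trans (cong ((x xor y) xor_) (xor-identityʳ y)) (xor-cancelʳ x y))
  ... | yes refl | no _ = at-aj (M a j) (M b j)
    where
    at-aj : ∀ x y → (if y ∨ false then not x else x) ≡ (x xor false) xor (y xor false)
    at-aj true  true  = refl
    at-aj true  false = refl
    at-aj false true  = refl
    at-aj false false = refl
  ... | no _ | yes refl rewrite M-sym i b = at-ia (M i a) (M b i)
    where
    at-ia : ∀ x y → (if y then not x else x) ≡ (x xor y) xor false
    at-ia true  true  = refl
    at-ia true  false = refl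
    at-ia false true  = refl
    at-ia false false = refl
  ... | no _ | no _ = sym (trans (xor-identityʳ _) (xor-identityʳ (M i j)))

  rank-principal-tildeAB : ∀ {M : Adj n} → IsSimpleGraph M → ∀ S → lookup S a ≡ lookup S b →
                           rank (principal (tildeAB a b M) S) ≡ rank (principal M S)
  rank-principal-tildeAB {M} M-simple S Sa≡Sb = by-Sa (lookup S a) refl
    where
    C = elems S
    by-Sa : ∀ v → lookup S a ≡ v → rank (principal (tildeAB a b M) S) ≡ rank (principal M S)
    by-Sa false Sa = cong rank (principal-tildeAB-∌ M S Sa)
    by-Sa true  Sa = begin
      rank (principal (tildeAB a b M) S)       ≡⟨ cong rank (rows-cong C C (tildeAB-elementary M-simple)) ⟩
      rank (rows (addRow a b (addCol a b M)) C C)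
        ≡⟨ rank-addRow a≢b u (∈-elems⁺ S Sa) b∈ (addCol a b M) C ⟩
      rank (rows (addCol a b M) C C)           ≡⟨ rank-addCol a≢b u b∈ M ⟩
      rank (principal M S)                     ∎
      where
      open ≡-Reasoning
      u = elems-unique S
      b∈ = ∈-elems⁺ S (trans (sym Sa≡Sb) Sa)

  exponent-toggleAB : ∀ (X : Adj n) A → lookup A a ≢ lookup A b → exponent (toggleAB a b X) A ≡ exponent X A
  exponent-toggleAB X A Aa≢Ab = cong₂ _+_
    (cong rank (principal-toggleAB X A Aa≢Ab))
    (cong rank (principal-toggleAB X (complement A) (λ e → Aa≢Ab (not-injective
      (trans (sym (lookup-map a not A)) (trans e (lookup-map b not A)))))))

  exponent-tildeAB : ∀ {X : Adj n} → IsSimpleGraph X → ∀ A → lookup A a ≡ lookup A b →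
                     exponent (tildeAB a b X) A ≡ exponent X A
  exponent-tildeAB X-simple A Aa≡Ab = cong₂ _+_
    (rank-principal-tildeAB X-simple A Aa≡Ab)
    (rank-principal-tildeAB X-simple (complement A)
      (trans (lookup-map a not A) (trans (cong not Aa≡Ab) (sym (lookup-map b not A)))))

  exponents-pair-up : ∀ {M : Adj n} → IsSimpleGraph M → ∀ A →
    (exponent M A ≡ exponent (toggleAB a b M) A × exponent (tildeAB a b M) A ≡ exponent (tildeAB' a b M) A) ⊎
    (exponent M A ≡ exponent (tildeAB a b M) A × exponent (toggleAB a b M) A ≡ exponent (tildeAB' a b M) A)
  exponents-pair-up {M} M-simple A with lookup A a ≟ᵇ lookup A b
  ... | no Aa≢Ab = inj₁ (sym (exponent-toggleAB M A Aa≢Ab) , sym (exponent-toggleAB (tildeAB a b M) A Aa≢Ab))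
  ... | yes Aa≡Ab = inj₂ (sym (exponent-tildeAB M-simple A Aa≡Ab) ,
                          trans (sym (exponent-tildeAB (toggleAB-simple M-simple) A Aa≡Ab))
                                (sym (exponent-cong (tildeAB-toggleAB M) A)))

module _ {X : Set} (k : ℕ) where

  count : (X → ℕ) → List X → ℕ
  count f xs = length (filter (λ x → k ℕ.≟ f x) xs)

  indicator : ℕ → ℕ
  indicator v = if does (k ℕ.≟ v) then 1 else 0

  count-∷ : ∀ f x xs → count f (x ∷ xs) ≡ indicator (f x) + count f xs
  count-∷ f x xs with does (k ℕ.≟ f x)
  ... | true  = refl
  ... | false = refl

  count-pairs : ∀ (f₁ f₂ f₃ f₄ : X → ℕ) →
                (∀ x → (f₁ x ≡ f₂ x × f₃ x ≡ f₄ x) ⊎ (f₁ x ≡ f₃ x × f₂ x ≡ f₄ x)) →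
                ∀ xs → count f₁ xs + count f₄ xs ≡ count f₂ xs + count f₃ xs
  count-pairs f₁ f₂ f₃ f₄ pair []       = refl
  count-pairs f₁ f₂ f₃ f₄ pair (x ∷ xs) = begin
    count f₁ (x ∷ xs) + count f₄ (x ∷ xs)
      ≡⟨ cong₂ _+_ (count-∷ f₁ x xs) (count-∷ f₄ x xs) ⟩
    (indicator (f₁ x) + count f₁ xs) + (indicator (f₄ x) + count f₄ xs)
      ≡⟨ interchange (indicator (f₁ x)) (count f₁ xs) (indicator (f₄ x)) (count f₄ xs) ⟩
    (indicator (f₁ x) + indicator (f₄ x)) + (count f₁ xs + count f₄ xs)
      ≡⟨ cong₂ _+_ (indicators (pair x)) (count-pairs f₁ f₂ f₃ f₄ pair xs) ⟩
    (indicator (f₂ x) + indicator (f₃ x)) + (count f₂ xs + count f₃ xs)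
      ≡⟨ interchange (indicator (f₂ x)) (indicator (f₃ x)) (count f₂ xs) (count f₃ xs) ⟩
    (indicator (f₂ x) + count f₂ xs) + (indicator (f₃ x) + count f₃ xs)
      ≡⟨ sym (cong₂ _+_ (count-∷ f₂ x xs) (count-∷ f₃ x xs)) ⟩
    count f₂ (x ∷ xs) + count f₃ (x ∷ xs) ∎
    where
    open ≡-Reasoning
    indicators : (f₁ x ≡ f₂ x × f₃ x ≡ f₄ x) ⊎ (f₁ x ≡ f₃ x × f₂ x ≡ f₄ x) →
                 indicator (f₁ x) + indicator (f₄ x) ≡ indicator (f₂ x) + indicator (f₃ x)
    indicators (inj₁ (e₁₂ , e₃₄)) = cong₂ _+_ (cong indicator e₁₂) (cong indicator (sym e₃₄))
    indicators (inj₂ (e₁₃ , e₂₄)) =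
      trans (cong₂ _+_ (cong indicator e₁₃) (cong indicator (sym e₂₄)))
            (+-comm (indicator (f₃ x)) (indicator (f₂ x)))

alternating-sum-zero : ∀ p₁ p₂ p₃ p₄ → p₁ + p₄ ≡ p₂ + p₃ →
                       ((ℤ.+ p₁ ℤ.- ℤ.+ p₂) ℤ.- ℤ.+ p₃) ℤ.+ ℤ.+ p₄ ≡ 0ℤ
alternating-sum-zero p₁ p₂ p₃ p₄ e = begin
  ((ℤ.+ p₁ ℤ.- ℤ.+ p₂) ℤ.- ℤ.+ p₃) ℤ.+ ℤ.+ p₄
    ≡⟨ solve 4 (λ x y z w → ((x :- y) :- z) :+ w := (x :+ w) :- (y :+ z)) refl
               (ℤ.+ p₁) (ℤ.+ p₂) (ℤ.+ p₃) (ℤ.+ p₄) ⟩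
  ℤ.+ (p₁ + p₄) ℤ.- ℤ.+ (p₂ + p₃)
    ≡⟨ cong (λ m → ℤ.+ m ℤ.- ℤ.+ (p₂ + p₃)) e ⟩
  ℤ.+ (p₂ + p₃) ℤ.- ℤ.+ (p₂ + p₃)
    ≡⟨ ℤ.+-inverseʳ (ℤ.+ (p₂ + p₃)) ⟩
  0ℤ ∎
  where
  open ≡-Reasoning
  open +-*-Solver

theorem1p2 : (n : ℕ) (M : Adj n) → IsSimpleGraph M → (a b : Fin n) → a ≢ b →
    (k : ℕ) → combCoeff a b M k ≡ 0ℤ
theorem1p2 n M M-simple a b a≢b k =
  alternating-sum-zero (pdgCoeff M k) (pdgCoeff (toggleAB a b M) k)
                       (pdgCoeff (tildeAB a b M) k) (pdgCoeff (tildeAB' a b M) k)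
    (count-pairs k (exponent M) (exponent (toggleAB a b M)) (exponent (tildeAB a b M)) (exponent (tildeAB' a b M))
                 (exponents-pair-up a≢b M-simple) (allSubsets n))
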